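{- Let $n\ge 1$. Define the snake ordering $<$ on $\{1,2,3\}^n$ recursively: for $n=1$, $1<2<3$; for $n>1$, writing $\tilde X$ for $X$ with its first letter deleted, $X<Y$ iff either $X_1<Y_1$, or $X_1=Y_1$ is odd and $\tilde X<\tilde Y$, or $X_1=Y_1$ is even and $\tilde X>\tilde Y$. Let $R$ be any subset of $\{(1,\ldots,1),(2,\ldots,2),(3,\ldots,3)\}$, and let $\Gamma$ be the pure simplicial complex on vertex set $[n]\times\{1,2,3\}$ whose facets are the simplices $F_X=\{(j,X_j): j\in[n]\}$ for $X\in\{1,2,3\}^n\setminus R$. Then listing the facets $F_X$, $X\in\{1,2,3\}^n\setminus R$, in increasing snake order is a shelling order of $\Gamma$.
   Context: A shelling order of a pure simplicial complex is an ordering $F_1,\ldots,F_m$ of its facets such that for each $k\ge 2$, $\left(\bigcup_{i<k}\overline{F_i}\right)\cap \overline{F_k}$ is pure of dimension $\dim F_k-1$; equivalently, for all $i<k$ there is $l<k$ with $F_i\cap F_k\subseteq F_l\cap F_k$ and $|F_l\cap F_k|=|F_k|-1$. Note $F_X\cap F_Y$ consists of the pairs $(j,X_j)$ with $X_j=Y_j$. -}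

module Defs where

open import Data.Nat using (ℕ; zero; suc; _+_)
open import Data.Fin using (Fin; zero; suc)
open import Data.Fin.Properties using (_≟_)
import Data.Fin as F
open import Data.Fin.Subset using (Subset; _∈_)
open import Data.Vec using (Vec; []; _∷_; lookup; replicate)
open import Data.List using (List; length; filter; cartesianProduct)
open import Data.List using () renaming (allFin to allFinL)
open import Data.Product using (_×_; _,_; Σ; ∃)
open import Data.Sum using (_⊎_)
open import Data.Empty using (⊥)
open import Relation.Nullary using (¬_; Dec)
open import Relation.Nullary.Decidable using (_×-dec_)
open import Relation.Binary.PropositionalEquality using (_≡_)

-- Letters {1,2,3} are encoded as Fin 3: zero ↦ 1, suc zero ↦ 2, suc (suc zero) ↦ 3.
Letter : Set
Letter = Fin 3

Word : ℕ → Set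
Word n = Vec Letter n

Even : Letter → Set
Even a = a ≡ suc zero

Odd : Letter → Set
Odd a = ¬ Even a

-- snake ordering on {1,2,3}^n (for n = 1 this reduces to X₁ < Y₁)
_<ₛ_ : ∀ {n} → Word n → Word n → Set
[] <ₛ [] = ⊥
(x ∷ xs) <ₛ (y ∷ ys) =
  (x F.< y)
  ⊎ ((x ≡ y) × Odd x × (xs <ₛ ys))
  ⊎ ((x ≡ y) × Even x × (ys <ₛ xs))

Vertex : ℕ → Set
Vertex n = Fin n × Letter

allVertices : (n : ℕ) → List (Vertex n)
allVertices n = cartesianProduct (allFinL n) (allFinL 3)

record Simplex (n : ℕ) : Set₁ where
  field
    mem  : Vertex n → Set
    mem? : (v : Vertex n) → Dec (mem v)
open Simplex public

facet : ∀ {n} → Word n → Simplex n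
facet X = record { mem = λ { (j , a) → lookup X j ≡ a }
                 ; mem? = λ { (j , a) → lookup X j ≟ a } }

_∩_ : ∀ {n} → Simplex n → Simplex n → Simplex n
S ∩ T = record { mem = λ v → mem S v × mem T v
               ; mem? = λ v → mem? S v ×-dec mem? T v }

_⊆_ : ∀ {n} → Simplex n → Simplex n → Set
S ⊆ T = ∀ v → mem S v → mem T v

card : ∀ {n} → Simplex n → ℕ
card {n} S = length (filter (mem? S) (allVertices n))

-- X lies in R ⊆ {(1,…,1),(2,…,2),(3,…,3)}, with R given by the set of
-- letters c whose constant word (c,…,c) belongs to R
InR : ∀ {n} → Subset 3 → Word n → Set
InR R X = Σ Letter λ c → (c ∈ R) × (X ≡ replicate _ c)

IsShellingOrder : ∀ {n} {I : Set} (W : I → Set) (_≺_ : I → I → Set)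
                  (F : I → Simplex n) → Set
IsShellingOrder {I = I} W _≺_ F =
  ∀ (i k : I) → W i → W k → i ≺ k →
  Σ I λ l → W l × (l ≺ k) × ((F i ∩ F k) ⊆ (F l ∩ F k))
            × (card (F l ∩ F k) + 1 ≡ card (F k))

-- Given X < Y, it suffices to find Z < Y, outside R, that differs from Y in a
-- single position at which X differs from Y too: then F_X ∩ F_Y ⊆ F_Z ∩ F_Y, a
-- ridge of F_Y.  If X₁ = Y₁, recurse on the tails,
-- searching above Ỹ instead of below it when the letter is 2; that case is
-- reduced to the other by the reflection 1 ↔ 3, which reverses the snake order.
-- If X₁ < Y₁, take Z = X₁Ỹ.  To keep Z outside R it is either X itself or
-- non-constant, and the only word Y where X₁Ỹ fails is Y₁X₁⋯X₁; there the change
-- is made in the tail instead, at the first position where X̃ leaves X₁⋯X₁.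
module Submission where

open import Data.Bool using (true; false)
open import Data.Empty using (⊥-elim)
open import Data.Fin using (Fin; zero; suc; opposite)
import Data.Fin as F
open import Data.Fin.Properties using (_≟_; <⇒≢; toℕ<n; opposite-prop; opposite-involutive)
open import Data.Fin.Subset using (Subset)
open import Data.List using (List; []; _∷_; _++_; length; filter; map; cartesianProduct)
open import Data.List using () renaming (allFin to allFinL)
open import Data.List.Properties using (filter-++; length-++; map-tabulate)
open import Data.Nat using (ℕ; suc; _+_; _<_; s≤s; z≤n)
open import Data.Nat.ListAction using (sum)
open import Data.Nat.Properties using (+-comm; ∸-monoʳ-<)
open import Data.Product using (_×_; _,_; ∃-syntax)
open import Data.Sum using (_⊎_; inj₁; inj₂)
open import Data.Vec using ([]; _∷_; head; replicate)
import Data.Vec as V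
import Data.Vec.Properties as VP
open import Function using (_∘_; id)
open import Level using (0ℓ)
open import Relation.Binary.PropositionalEquality
open import Relation.Nullary using (¬_; yes; no; does)
open import Relation.Nullary.Decidable using (_×-dec_)
open import Relation.Unary using (Pred; Decidable)

open import Defs

pattern one   = zero
pattern two   = suc zero
pattern three = suc (suc zero)

module _ {A B : Set} {P : Pred (A × B) 0ℓ} (P? : Decidable P) where

  length-filter-map-pair : ∀ x (ys : List B) →
    length (filter P? (map (x ,_) ys)) ≡ length (filter (P? ∘ (x ,_)) ys)
  length-filter-map-pair x [] = refl
  length-filter-map-pair x (y ∷ ys) with does (P? (x , y))
  ... | true  = cong suc (length-filter-map-pair x ys)
  ... | false = length-filter-map-pair x ys

  length-filter-cartesianProduct : (xs : List A) (ys : List B) →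
    length (filter P? (cartesianProduct xs ys)) ≡
    sum (map (λ x → length (filter (P? ∘ (x ,_)) ys)) xs)
  length-filter-cartesianProduct [] ys = refl
  length-filter-cartesianProduct (x ∷ xs) ys = begin
    length (filter P? (map (x ,_) ys ++ cartesianProduct xs ys))
      ≡⟨ cong length (filter-++ P? (map (x ,_) ys) _) ⟩
    length (filter P? (map (x ,_) ys) ++ filter P? (cartesianProduct xs ys))
      ≡⟨ length-++ (filter P? (map (x ,_) ys)) ⟩
    length (filter P? (map (x ,_) ys)) + length (filter P? (cartesianProduct xs ys))
      ≡⟨ cong₂ _+_ (length-filter-map-pair x ys) (length-filter-cartesianProduct xs ys) ⟩
    _ ∎
    where open ≡-Reasoning

sum-map-allFin-suc : ∀ {n} (f : Fin (suc n) → ℕ) →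
  sum (map f (allFinL (suc n))) ≡ f zero + sum (map (f ∘ suc) (allFinL n))
sum-map-allFin-suc f = cong (λ xs → f zero + sum xs)
  (trans (map-tabulate suc f) (sym (map-tabulate id (f ∘ suc))))

card-as-sum : ∀ {n} (S : Simplex n) →
  card S ≡ sum (map (λ j → length (filter (mem? S ∘ (j ,_)) (allFinL 3))) (allFinL n))
card-as-sum {n} S = length-filter-cartesianProduct (mem? S) (allFinL n) (allFinL 3)

occurrences : Letter → ℕ
occurrences x = length (filter (x ≟_) (allFinL 3))

occurrences≡1 : ∀ x → occurrences x ≡ 1
occurrences≡1 one   = refl
occurrences≡1 two   = refl
occurrences≡1 three = refl

commonLetters : Letter → Letter → ℕ
commonLetters x y = length (filter (λ a → (x ≟ a) ×-dec (y ≟ a)) (allFinL 3))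

commonLetters-refl : ∀ x → commonLetters x x ≡ 1
commonLetters-refl one   = refl
commonLetters-refl two   = refl
commonLetters-refl three = refl

commonLetters-≢ : ∀ x y → x ≢ y → commonLetters x y ≡ 0
commonLetters-≢ one   one   x≢y = ⊥-elim (x≢y refl)
commonLetters-≢ one   two   _   = refl
commonLetters-≢ one   three _   = refl
commonLetters-≢ two   one   _   = refl
commonLetters-≢ two   two   x≢y = ⊥-elim (x≢y refl)
commonLetters-≢ two   three _   = refl
commonLetters-≢ three one   _   = refl
commonLetters-≢ three two   _   = refl
commonLetters-≢ three three x≢y = ⊥-elim (x≢y refl)

agreements : ∀ {n} → Word n → Word n → ℕ
agreements []       []       = 0
agreements (x ∷ xs) (y ∷ ys) = commonLetters x y + agreements xs ys

agreements-refl : ∀ {n} (X : Word n) → agreements X X ≡ n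
agreements-refl []       = refl
agreements-refl (x ∷ xs) = cong₂ _+_ (commonLetters-refl x) (agreements-refl xs)

card-facet : ∀ {n} (X : Word n) → card (facet X) ≡ n
card-facet X = trans (card-as-sum (facet X)) (sum-occurrences X)
  where
  sum-occurrences : ∀ {n} (X : Word n) →
    sum (map (occurrences ∘ V.lookup X) (allFinL n)) ≡ n
  sum-occurrences []       = refl
  sum-occurrences (x ∷ xs) = trans (sum-map-allFin-suc (occurrences ∘ V.lookup (x ∷ xs)))
    (cong₂ _+_ (occurrences≡1 x) (sum-occurrences xs))

card-facet-∩ : ∀ {n} (X Y : Word n) → card (facet X ∩ facet Y) ≡ agreements X Y
card-facet-∩ X Y = trans (card-as-sum (facet X ∩ facet Y)) (sum-common X Y)
  where
  sum-common : ∀ {n} (X Y : Word n) →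
    sum (map (λ j → commonLetters (V.lookup X j) (V.lookup Y j)) (allFinL n)) ≡ agreements X Y
  sum-common []       []       = refl
  sum-common (x ∷ xs) (y ∷ ys) =
    trans (sum-map-allFin-suc (λ j → commonLetters (V.lookup (x ∷ xs) j) (V.lookup (y ∷ ys) j)))
    (cong (commonLetters x y +_) (sum-common xs ys))

data OneDiff : ∀ {n} → Word n → Word n → Word n → Set where
  here  : ∀ {n a b c} {is ks : Word n} →
          b ≢ c → a ≢ c → OneDiff (a ∷ is) (b ∷ ks) (c ∷ ks)
  there : ∀ {n a c} {is ls ks : Word n} →
          OneDiff is ls ks → OneDiff (a ∷ is) (c ∷ ls) (c ∷ ks)

OneDiff⇒∩-⊆ : ∀ {n} {i l k : Word n} → OneDiff i l k → (facet i ∩ facet k) ⊆ (facet l ∩ facet k)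
OneDiff⇒∩-⊆ (here _ a≢c) (zero , _)  (refl , refl) = ⊥-elim (a≢c refl)
OneDiff⇒∩-⊆ (here _ _)   (suc j , _) (_ , q)       = q , q
OneDiff⇒∩-⊆ (there _)    (zero , _)  (_ , q)       = q , q
OneDiff⇒∩-⊆ (there d)    (suc j , a) p             = OneDiff⇒∩-⊆ d (j , a) p

OneDiff⇒agreements : ∀ {n} {i l k : Word n} → OneDiff i l k → suc (agreements l k) ≡ n
OneDiff⇒agreements (here {b = b} {c} {ks = ks} b≢c _) =
  cong suc (cong₂ _+_ (commonLetters-≢ b c b≢c) (agreements-refl ks))
OneDiff⇒agreements (there {c = c} {ls = ls} {ks} d) =
  cong suc (trans (cong (_+ agreements ls ks) (commonLetters-refl c)) (OneDiff⇒agreements d))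

OneDiff⇒ridge : ∀ {n} {i l k : Word n} → OneDiff i l k →
  card (facet l ∩ facet k) + 1 ≡ card (facet k)
OneDiff⇒ridge {l = l} {k} d = begin
  card (facet l ∩ facet k) + 1 ≡⟨ cong (_+ 1) (card-facet-∩ l k) ⟩
  agreements l k + 1           ≡⟨ +-comm (agreements l k) 1 ⟩
  suc (agreements l k)         ≡⟨ OneDiff⇒agreements d ⟩
  _                            ≡⟨ card-facet k ⟨
  card (facet k)               ∎
  where open ≡-Reasoning

<ₛ-head : ∀ {n x y} {xs ys : Word n} → x F.< y → (x ∷ xs) <ₛ (y ∷ ys)
<ₛ-head = inj₁

<ₛ-odd : ∀ {n x} {xs ys : Word n} → Odd x → xs <ₛ ys → (x ∷ xs) <ₛ (x ∷ ys)
<ₛ-odd odd xs<ys = inj₂ (inj₁ (refl , odd , xs<ys))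

<ₛ-even : ∀ {n x} {xs ys : Word n} → Even x → ys <ₛ xs → (x ∷ xs) <ₛ (x ∷ ys)
<ₛ-even even ys<xs = inj₂ (inj₂ (refl , even , ys<xs))

opposite-reverses-< : ∀ {n} {x y : Fin n} → x F.< y → opposite y F.< opposite x
opposite-reverses-< {x = x} {y} x<y =
  subst₂ _<_ (sym (opposite-prop y)) (sym (opposite-prop x)) (∸-monoʳ-< (s≤s x<y) (toℕ<n y))

opposite-even : ∀ {x} → Even x → Even (opposite x)
opposite-even refl = refl

opposite-odd : ∀ {x} → Odd x → Odd (opposite x)
opposite-odd {x} odd even = odd (subst Even (opposite-involutive x) (opposite-even even))

reflect : ∀ {n} → Word n → Word n
reflect = V.map opposite

reflect-involutive : ∀ {n} (X : Word n) → reflect (reflect X) ≡ X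
reflect-involutive X = begin
  reflect (reflect X) ≡⟨ VP.map-∘ opposite opposite X ⟨
  V.map (opposite ∘ opposite) X ≡⟨ VP.map-cong opposite-involutive X ⟩
  V.map id X ≡⟨ VP.map-id X ⟩
  X ∎
  where open ≡-Reasoning

reflect-reverses-<ₛ : ∀ {n} {X Y : Word n} → X <ₛ Y → reflect Y <ₛ reflect X
reflect-reverses-<ₛ {X = []} {[]} ()
reflect-reverses-<ₛ {X = _ ∷ _} {_ ∷ _} (inj₁ x<y)                      = <ₛ-head (opposite-reverses-< x<y)
reflect-reverses-<ₛ {X = _ ∷ _} {_ ∷ _} (inj₂ (inj₁ (refl , odd , t)))  = <ₛ-odd (opposite-odd odd) (reflect-reverses-<ₛ t)
reflect-reverses-<ₛ {X = _ ∷ _} {_ ∷ _} (inj₂ (inj₂ (refl , even , t))) = <ₛ-even (opposite-even even) (reflect-reverses-<ₛ t)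

NonConstant : ∀ {n} → Word n → Set
NonConstant {n} X = ∀ c → X ≢ replicate n c

NonConstant⇒¬InR : ∀ {n} R {X : Word n} → NonConstant X → ¬ InR R X
NonConstant⇒¬InR R nc (c , _ , X≡cⁿ) = nc c X≡cⁿ

∷-nonConstant : ∀ {n} x {xs : Word n} → xs ≢ replicate n x → NonConstant (x ∷ xs)
∷-nonConstant x xs≢xⁿ c refl = xs≢xⁿ refl

∷-nonConstant-head : ∀ {n} x {xs : Word (suc n)} → head xs ≢ x → NonConstant (x ∷ xs)
∷-nonConstant-head x head≢x c refl = head≢x refl

reflect-replicate : ∀ n c → reflect (replicate n c) ≡ replicate n (opposite c)
reflect-replicate n c = VP.map-replicate opposite c n

reflect-nonConstant : ∀ {n} {X : Word n} → NonConstant X → NonConstant (reflect X)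
reflect-nonConstant {n} {X} nc c X′≡cⁿ = nc (opposite c) (begin
  X                                ≡⟨ reflect-involutive X ⟨
  reflect (reflect X)              ≡⟨ cong reflect X′≡cⁿ ⟩
  reflect (replicate n c)          ≡⟨ reflect-replicate n c ⟩
  replicate n (opposite c)         ∎)
  where open ≡-Reasoning

reflect-oneDiff : ∀ {n} {i l k : Word n} → OneDiff i l k → OneDiff (reflect i) (reflect l) (reflect k)
reflect-oneDiff (here b≢c a≢c) = here (b≢c ∘ opposite-injective) (a≢c ∘ opposite-injective)
  where
  opposite-injective : ∀ {x y : Letter} → opposite x ≡ opposite y → x ≡ y
  opposite-injective {x} {y} eq =
    trans (sym (opposite-involutive x)) (trans (cong opposite eq) (opposite-involutive y))
reflect-oneDiff (there d) = there (reflect-oneDiff d)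

ShellingWitness : ∀ {n} → Word n → Word n → Word n → Set
ShellingWitness i l k = OneDiff i l k × (l ≡ i ⊎ NonConstant l)

∷-witness : ∀ {n} x {i l k : Word n} → ShellingWitness i l k → ShellingWitness (x ∷ i) (x ∷ l) (x ∷ k)
∷-witness x (d , inj₁ refl) = there d , inj₁ refl
∷-witness x (d , inj₂ nc)   = there d , inj₂ (λ c eq → nc c (VP.∷-injectiveʳ eq))

reflect-witness : ∀ {n} {i l k : Word n} →
  ShellingWitness i l k → ShellingWitness (reflect i) (reflect l) (reflect k)
reflect-witness (d , inj₁ refl) = reflect-oneDiff d , inj₁ refl
reflect-witness (d , inj₂ nc)   = reflect-oneDiff d , inj₂ (reflect-nonConstant nc)

admissible⇒¬InR : ∀ {n} R {i l : Word n} → l ≡ i ⊎ NonConstant l → ¬ InR R i → ¬ InR R l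
admissible⇒¬InR R (inj₁ refl) i∉R = i∉R
admissible⇒¬InR R (inj₂ nc)   _   = NonConstant⇒¬InR R nc

raise-ones : ∀ {n} (w : Word (suc n)) → w ≢ replicate (suc n) one →
  ∃[ t ] replicate (suc n) one <ₛ t × OneDiff w t (replicate (suc n) one) × head t ≢ two
raise-ones (one ∷ []) w≢1ⁿ = ⊥-elim (w≢1ⁿ refl)
raise-ones (one ∷ w@(_ ∷ _)) w≢1ⁿ with t , 1ⁿ<t , d , _ ← raise-ones w (w≢1ⁿ ∘ cong (one ∷_)) =
  one ∷ t , <ₛ-odd (λ ()) 1ⁿ<t , there d , λ ()
raise-ones {n} (suc _ ∷ _) _ = three ∷ replicate n one , <ₛ-head (s≤s z≤n) , here (λ ()) (λ ()) , λ ()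

mutual
  raise-twos : ∀ {n} (w : Word (suc n)) → w ≢ replicate (suc n) two →
    ∃[ t ] replicate (suc n) two <ₛ t × OneDiff w t (replicate (suc n) two)
  raise-twos (two ∷ []) w≢2ⁿ = ⊥-elim (w≢2ⁿ refl)
  raise-twos (two ∷ w@(_ ∷ _)) w≢2ⁿ with t , t<2ⁿ , d , _ ← lower-twos w (w≢2ⁿ ∘ cong (two ∷_)) =
    two ∷ t , <ₛ-even refl t<2ⁿ , there d
  raise-twos {n} (one ∷ _) _ =
    three ∷ replicate n two , <ₛ-head (s≤s (s≤s z≤n)) , here (λ ()) (λ ())
  raise-twos {n} (three ∷ _) _ =
    three ∷ replicate n two , <ₛ-head (s≤s (s≤s z≤n)) , here (λ ()) (λ ())

  lower-twos : ∀ {n} (w : Word (suc n)) → w ≢ replicate (suc n) two →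
    ∃[ t ] t <ₛ replicate (suc n) two × OneDiff w t (replicate (suc n) two) × head t ≢ three
  lower-twos (two ∷ []) w≢2ⁿ = ⊥-elim (w≢2ⁿ refl)
  lower-twos (two ∷ w@(_ ∷ _)) w≢2ⁿ with t , 2ⁿ<t , d ← raise-twos w (w≢2ⁿ ∘ cong (two ∷_)) =
    two ∷ t , <ₛ-even refl 2ⁿ<t , there d , λ ()
  lower-twos {n} (one ∷ _) _ =
    one ∷ replicate n two , <ₛ-head (s≤s z≤n) , here (λ ()) (λ ()) , λ ()
  lower-twos {n} (three ∷ _) _ =
    one ∷ replicate n two , <ₛ-head (s≤s z≤n) , here (λ ()) (λ ()) , λ ()

witness-corner : ∀ {n x y} {xs : Word n} → x F.< y → xs ≢ replicate n x →
  ∃[ l ] l <ₛ (y ∷ replicate n x) × ShellingWitness (x ∷ xs) l (y ∷ replicate n x)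
witness-corner {xs = []} _ xs≢xⁿ = ⊥-elim (xs≢xⁿ refl)
witness-corner {suc n} {one} {two} {xs@(_ ∷ _)} _ xs≢1ⁿ
  with t , 1ⁿ<t , d , head≢2 ← raise-ones xs xs≢1ⁿ =
  two ∷ t , <ₛ-even refl 1ⁿ<t , there d , inj₂ (∷-nonConstant-head two head≢2)
witness-corner {suc n} {one} {three} {_ ∷ _} _ _ =
  two ∷ replicate (suc n) one , <ₛ-head (s≤s (s≤s z≤n)) , here (λ ()) (λ ()) ,
  inj₂ (∷-nonConstant-head two (λ ()))
witness-corner {suc n} {two} {three} {xs@(_ ∷ _)} _ xs≢2ⁿ
  with t , t<2ⁿ , d , head≢3 ← lower-twos xs xs≢2ⁿ =
  three ∷ t , <ₛ-odd (λ ()) t<2ⁿ , there d , inj₂ (∷-nonConstant-head three head≢3)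
witness-corner {x = one}   {one}   {_ ∷ _} () _
witness-corner {x = two}   {one}   {_ ∷ _} () _
witness-corner {x = two}   {two}   {_ ∷ _} (s≤s ()) _
witness-corner {x = three} {one}   {_ ∷ _} () _
witness-corner {x = three} {two}   {_ ∷ _} (s≤s ()) _
witness-corner {x = three} {three} {_ ∷ _} (s≤s (s≤s ())) _

witness-head : ∀ {n x y} (xs ys : Word n) → x F.< y →
  ∃[ l ] l <ₛ (y ∷ ys) × ShellingWitness (x ∷ xs) l (y ∷ ys)
witness-head {n} {x} xs ys x<y with VP.≡-dec _≟_ ys (replicate n x)
... | no ys≢xⁿ = x ∷ ys , <ₛ-head x<y , here (<⇒≢ x<y) (<⇒≢ x<y) , inj₂ (∷-nonConstant x ys≢xⁿ)
... | yes refl with VP.≡-dec _≟_ xs (replicate n x)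
...   | yes refl  = x ∷ xs , <ₛ-head x<y , here (<⇒≢ x<y) (<⇒≢ x<y) , inj₁ refl
...   | no xs≢xⁿ = witness-corner x<y xs≢xⁿ

mutual
  witness-below : ∀ {n} {i k : Word n} → i <ₛ k → ∃[ l ] l <ₛ k × ShellingWitness i l k
  witness-below {i = []} {[]} ()
  witness-below {i = _ ∷ xs} {_ ∷ ys} (inj₁ x<y) = witness-head xs ys x<y
  witness-below {i = x ∷ _} {_ ∷ _} (inj₂ (inj₁ (refl , odd , xs<ys)))
    with l , l<ys , w ← witness-below xs<ys = x ∷ l , <ₛ-odd odd l<ys , ∷-witness x w
  witness-below {i = x ∷ _} {_ ∷ _} (inj₂ (inj₂ (refl , even , ys<xs)))
    with l , ys<l , w ← witness-above ys<xs = x ∷ l , <ₛ-even even ys<l , ∷-witness x w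

  witness-above : ∀ {n} {i k : Word n} → k <ₛ i → ∃[ l ] k <ₛ l × ShellingWitness i l k
  witness-above {i = i} {k} k<i
    with l , l<k′ , w ← witness-below (reflect-reverses-<ₛ k<i) =
    reflect l ,
    subst (_<ₛ reflect l) (reflect-involutive k) (reflect-reverses-<ₛ l<k′) ,
    subst₂ (λ i′ k′ → ShellingWitness i′ (reflect l) k′)
           (reflect-involutive i) (reflect-involutive k) (reflect-witness w)

mainTheorem3 : (m : ℕ) (R : Subset 3) →
    IsShellingOrder {n = suc m} (λ X → ¬ InR R X) _<ₛ_ facet
mainTheorem3 m R i k i∉R _ i<k with l , l<k , d , admissible ← witness-below i<k =
  l , admissible⇒¬InR R admissible i∉R , l<k , OneDiff⇒∩-⊆ d , OneDiff⇒ridge d
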